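{- Work in intensional Martin-Löf type theory with a cumulative hierarchy of univalent universes. Let $n$ be a natural number, $(A,a)$ a pointed type in a universe $\mathcal{U}$, and $(P,p)$ a pointed family over $(A,a)$ (i.e. $P : A \to \mathcal{U}$ and $p : P(a)$) such that $P(x)$ is an $(n-2)$-type for every $x:A$. Then $$\Omega^n\Big(\sum_{x:A} P(x),\ (a,p)\Big) = \Omega^n(A,a).$$
   Context: The ambient theory is intensional Martin-Löf type theory with a cumulative hierarchy of universes $\mathcal{U}_0:\mathcal{U}_1:\dots$, each satisfying univalence; no higher inductive types. "$=$" denotes the identity type (here, between pointed types, i.e. elements of $\sum_{B:\mathcal{U}} B$). Truncation levels: $\mathsf{is}\text{ - }(-2)\text{ - }\mathsf{type}(B):\equiv\sum_{b:B}\prod_{x:B} b=x$ and $\mathsf{is}\text{ - }(k+1)\text{ - }\mathsf{type}(B):\equiv\prod_{x,y:B}\mathsf{is}\text{ - }k\text{ - }\mathsf{type}(x=y)$; $B$ is a $k$-type if this is inhabited. Loop spaces: $\Omega(B,b):\equiv((b=b),\mathsf{refl}_b)$, $\Omega^0(B,b):\equiv(B,b)$, $\Omega^{k+1}(B,b):\equiv\Omega^k(\Omega(B,b))$. -}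

{-# OPTIONS --without-K #-}
module Defs where

open import Level using (Level; _⊔_; suc)
open import Data.Nat using (ℕ; zero) renaming (suc to succ)
open import Data.Product using (Σ; _,_; proj₁; proj₂; _×_)
open import Relation.Binary.PropositionalEquality using (_≡_; refl)

_∼_ : ∀ {a b} {A : Set a} {B : A → Set b} (f g : (x : A) → B x) → Set (a ⊔ b)
f ∼ g = ∀ x → f x ≡ g x

isEquiv : ∀ {a b} {A : Set a} {B : Set b} (f : A → B) → Set (a ⊔ b)
isEquiv {A = A} {B} f =
  (Σ (B → A) λ g → (λ y → f (g y)) ∼ (λ y → y)) ×
  (Σ (B → A) λ h → (λ x → h (f x)) ∼ (λ x → x))

_≃_ : ∀ {a b} → Set a → Set b → Set (a ⊔ b)
A ≃ B = Σ (A → B) isEquiv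

idtoeqv : ∀ {ℓ} {A B : Set ℓ} → A ≡ B → A ≃ B
idtoeqv refl = (λ x → x) , ((λ x → x) , λ _ → refl) , ((λ x → x) , λ _ → refl)

Univalence : (ℓ : Level) → Set (suc ℓ)
Univalence ℓ = (A B : Set ℓ) → isEquiv (idtoeqv {ℓ} {A} {B})

-- Truncation levels, indexed with an offset of 2:
-- is-⟨ k - 2 ⟩-type B  means  B is a (k-2)-type.
isContr : ∀ {ℓ} → Set ℓ → Set ℓ
isContr B = Σ B λ b → (x : B) → b ≡ x

is-⟨_-2⟩-type : ℕ → ∀ {ℓ} → Set ℓ → Set ℓ
is-⟨ zero -2⟩-type B = isContr B
is-⟨ succ k -2⟩-type B = (x y : B) → is-⟨ k -2⟩-type (x ≡ y)

Pointed : (ℓ : Level) → Set (suc ℓ)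
Pointed ℓ = Σ (Set ℓ) λ B → B

Ω : ∀ {ℓ} → Pointed ℓ → Pointed ℓ
Ω (B , b) = (b ≡ b) , refl

Ω^ : ℕ → ∀ {ℓ} → Pointed ℓ → Pointed ℓ
Ω^ zero X = X
Ω^ (succ k) X = Ω^ k (Ω X)

{-# OPTIONS --without-K #-}
module Submission where

-- For n = 0 the fibres are contractible, so the first projection
-- Σ A P → A is an equivalence of pointed types. For n + 1, the loop space of
-- Σ A P at (a , p) is the Σ-type over Ω (A , a) of the paths transport q p ≡ p;
-- these lie in P a, so they form a family of (n - 2)-types and the induction
-- hypothesis applies to this family over a ≡ a.

open import Defs
open import Level using (Level)
open import Data.Nat using (ℕ; zero) renaming (suc to succ)
open import Data.Product using (Σ; _,_; proj₁; proj₂)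
open import Relation.Binary.PropositionalEquality using (_≡_; refl; cong; subst; trans)

Σ-≡-≃ : ∀ {a b} {A : Set a} (P : A → Set b) {x y : A} {p : P x} {q : P y} →
        ((x , p) ≡ (y , q)) ≃ Σ (x ≡ y) (λ e → subst P e p ≡ q)
Σ-≡-≃ P = split , (pair , split∘pair) , (pair , pair∘split)
  where
  split : ∀ {x y p q} → (x , p) ≡ (y , q) → Σ (x ≡ y) (λ e → subst P e p ≡ q)
  split refl = refl , refl
  pair : ∀ {x y p q} → Σ (x ≡ y) (λ e → subst P e p ≡ q) → (x , p) ≡ (y , q)
  pair (refl , refl) = refl
  split∘pair : ∀ {x y p q} (w : Σ (x ≡ y) (λ e → subst P e p ≡ q)) → split (pair w) ≡ w
  split∘pair (refl , refl) = refl
  pair∘split : ∀ {x y p q} (w : (x , p) ≡ (y , q)) → pair (split w) ≡ w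
  pair∘split refl = refl

proj₁-isEquiv : ∀ {a b} {A : Set a} {P : A → Set b} →
                ((x : A) → isContr (P x)) → isEquiv (proj₁ {B = P})
proj₁-isEquiv {A = A} {P} c = (centre , λ _ → refl) , (centre , λ { (x , y) → cong (x ,_) (proj₂ (c x) y) })
  where
  centre : A → Σ A P
  centre x = x , proj₁ (c x)

module _ {ℓ : Level} (ua : Univalence ℓ) where

  idtoeqv-pointed : {A B : Set ℓ} (e : A ≡ B) (a : A) →
                    _≡_ {A = Pointed ℓ} (A , a) (B , proj₁ (idtoeqv e) a)
  idtoeqv-pointed refl a = refl

  ≃-pointed-≡ : {A B : Set ℓ} (f : A ≃ B) {a : A} {b : B} → proj₁ f a ≡ b →
                _≡_ {A = Pointed ℓ} (A , a) (B , b)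
  ≃-pointed-≡ {A} {B} f {a} fa≡b with ua A B
  ... | (ua⁻¹ , idtoeqv∘ua⁻¹) , _ =
    trans (idtoeqv-pointed (ua⁻¹ f) a)
          (cong (B ,_) (trans (cong (λ g → proj₁ g a) (idtoeqv∘ua⁻¹ f)) fa≡b))

  Ω-Σ : {A : Set ℓ} (P : A → Set ℓ) {a : A} (p : P a) →
        Ω (Σ A P , (a , p)) ≡ (Σ (a ≡ a) (λ q → subst P q p ≡ p) , (refl , refl))
  Ω-Σ P p = ≃-pointed-≡ (Σ-≡-≃ P) refl

  Ω^-Σ-truncated : (n : ℕ) (A : Set ℓ) (a : A) (P : A → Set ℓ) (p : P a) →
                   ((x : A) → is-⟨ n -2⟩-type (P x)) →
                   Ω^ n (Σ A P , (a , p)) ≡ Ω^ n (A , a)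
  Ω^-Σ-truncated zero A a P p c = ≃-pointed-≡ (proj₁ , proj₁-isEquiv c) refl
  Ω^-Σ-truncated (succ n) A a P p t =
    trans (cong (Ω^ n) (Ω-Σ P p))
          (Ω^-Σ-truncated n (a ≡ a) refl (λ q → subst P q p ≡ p) refl
                          (λ q → t a (subst P q p) p))

lemma5p1 : (ua : ∀ {ℓ′ : Level} → Univalence ℓ′) →
    ∀ {ℓ : Level} (n : ℕ) (A : Set ℓ) (a : A) (P : A → Set ℓ) (p : P a) →
    ((x : A) → is-⟨ n -2⟩-type (P x)) →
    Ω^ n ((Σ A P) , (a , p)) ≡ Ω^ n (A , a)
lemma5p1 ua {ℓ} = Ω^-Σ-truncated (ua {ℓ})
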